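{- Let $1\leq k<d$ be integers, let $G=(V,E)$ be a finite simple graph with a fixed vertex $v_0$, and let $p:V\to\mathbb{R}^d$ satisfy $p_i(v_0)\neq 0$ for all $i\in\{d-k+1,\ldots,d\}$. Let $\sigma\in\mathbb{R}^E$ and $\lambda\in\mathbb{R}^{(V\setminus\{v_0\})\times\{d-k+1,\ldots,d\}}$. Then $(\sigma,\lambda)\in\ker J_{v_0}(G,p)^T$ if and only if $\sigma\in\ker DR_k(G,p)^T$ and $$\lambda(v,i)=-p_i(v_0)\sum_{w\in N_G(v)}\sigma(vw)\bigl(p_i(v)-p_i(w)\bigr)$$ for every $v\in V\setminus\{v_0\}$ and every $i\in\{d-k+1,\ldots,d\}$.
   Context: $p_i$ is the $i$-th coordinate of $p$ and $\tilde p=(p_1,\ldots,p_{d-k}):V\to\mathbb{R}^{d-k}$; $N_G(v)$ is the neighbour set of $v$. For $x:V\to\mathbb{R}^m$, $R(G,x)$ is the $|E|\times m|V|$ rigidity matrix whose row for $vw$ has $x(v)-x(w)$ in the columns of $v$, $x(w)-x(v)$ in the columns of $w$, zeros elsewhere. For $y:V\to\mathbb{R}$, $f_{G,1}(y)\in\mathbb{R}^E$ has entries $(y(v)-y(w))^2$. $DR_k(G,p)=[\,R(G,\tilde p)\ \ f_{G,1}(p_{d-k+1})\ \cdots\ f_{G,1}(p_d)\,]$, an $|E|\times((d-k)|V|+k)$ matrix. $J_{v_0}(G,p)$ has rows indexed first by $E$ and then by pairs $(v,i)$, $v\in V\setminus\{v_0\}$, $i\in\{d-k+1,\ldots,d\}$,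 and columns indexed by pairs $(u,j)$, $u\in V$, $j\in\{1,\ldots,d\}$: the edge row $vw$ has $p_j(v)-p_j(w)$ in column $(v,j)$ and $p_j(w)-p_j(v)$ in column $(w,j)$ for all $j$, zeros elsewhere; row $(v,i)$ has $1/p_i(v_0)$ in column $(v,i)$, $-p_i(v)/p_i(v_0)^2$ in column $(v_0,i)$, zeros elsewhere. The vector $(\sigma,\lambda)$ is indexed compatibly with the rows of $J_{v_0}(G,p)$. -}

module Defs where

open import Level using (Level; _⊔_) renaming (suc to lsuc)
open import Algebra.Bundles using (CommutativeRing)
open import Data.Nat as ℕ using (ℕ; _≤_; _<_)
open import Data.Nat.Properties using (m∸n≤m; m∸n+n≡m)
open import Data.Fin as Fin using (Fin; punchIn; inject≤; cast; _↑ʳ_)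
open import Data.Fin.Properties using (_≟_)
open import Data.Product using (_×_; _,_; proj₁; proj₂)
open import Data.Sum using (_⊎_; inj₁; inj₂)
open import Relation.Nullary using (¬_; yes; no)
open import Relation.Binary.PropositionalEquality using (_≡_)
open import Function.Definitions using (Injective)

record Field (c ℓ : Level) : Set (lsuc (c ⊔ ℓ)) where
  field
    commutativeRing : CommutativeRing c ℓ
  open CommutativeRing commutativeRing public
  field
    0≉1   : ¬ (0# ≈ 1#)
    inv   : (x : Carrier) → ¬ (x ≈ 0#) → Carrier
    inv-r : (x : Carrier) (x≉0 : ¬ (x ≈ 0#)) → x * inv x x≉0 ≈ 1#

-- The edge set is E = Fin m; edge e joins  tl e  and  hd e  with
-- tl e < hd e (no loops, each unordered edge listed in a fixed
-- orientation) and the edge map is injective (no multiple edges).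

record SimpleGraph (nv : ℕ) : Set where
  field
    m     : ℕ
    edge  : Fin m → Fin nv × Fin nv
    tl<hd : ∀ e → proj₁ (edge e) Fin.< proj₂ (edge e)
    inj   : Injective _≡_ _≡_ edge
  tl hd : Fin m → Fin nv
  tl e = proj₁ (edge e)
  hd e = proj₂ (edge e)

-- Coordinates: Fin d = {1,…,d}.  The first d-k coordinates are
-- bot j (j : Fin (d ∸ k)); the last k coordinates d-k+1,…,d are
-- top i (i : Fin k), top i being coordinate (d-k) + i.

bot : ∀ {d} k → Fin (d ℕ.∸ k) → Fin d
bot {d} k j = inject≤ j (m∸n≤m d k)

top : ∀ {d k} → k ≤ d → Fin k → Fin d
top {d} {k} k≤d i = cast (m∸n+n≡m k≤d) ((d ℕ.∸ k) ↑ʳ i)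

module _ {c ℓ : Level} (F : Field c ℓ) where
  open Field F

  ∑ : (n : ℕ) → (Fin n → Carrier) → Carrier
  ∑ ℕ.zero    f = 0#
  ∑ (ℕ.suc n) f = f Fin.zero + ∑ n (λ i → f (Fin.suc i))

  _² : Carrier → Carrier
  x ² = x * x

  module _ {nv : ℕ} (G : SimpleGraph nv) where
    open SimpleGraph G

    R : ∀ {r} → (Fin nv → Fin r → Carrier) → Fin m → (Fin nv × Fin r) → Carrier
    R x e (v , j) with v ≟ tl e | v ≟ hd e
    ... | yes _ | _     = x (tl e) j - x (hd e) j
    ... | no _  | yes _ = x (hd e) j - x (tl e) j
    ... | no _  | no _  = 0#

    f1 : (Fin nv → Carrier) → Fin m → Carrier
    f1 y e = (y (tl e) - y (hd e)) ²

    DR : ∀ {d} k → k ≤ d → (Fin nv → Fin d → Carrier) →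
         Fin m → (Fin nv × Fin (d ℕ.∸ k)) ⊎ Fin k → Carrier
    DR k k≤d p e (inj₁ col) = R (λ v j → p v (bot k j)) e col
    DR k k≤d p e (inj₂ i)   = f1 (λ v → p v (top k≤d i)) e

    InKerDRᵀ : ∀ {d} k → k ≤ d → (Fin nv → Fin d → Carrier) → (Fin m → Carrier) → Set ℓ
    InKerDRᵀ k k≤d p σ = ∀ col → ∑ m (λ e → DR k k≤d p e col * σ e) ≈ 0#

    -- 1 if e joins v and w, 0 otherwise  (used to write Σ_{w ∈ N_G(v)})
    joins : Fin m → Fin nv → Fin nv → Carrier
    joins e v w with tl e ≟ v | hd e ≟ w | tl e ≟ w | hd e ≟ v
    ... | yes _ | yes _ | _     | _     = 1#
    ... | _     | _     | yes _ | yes _ = 1#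
    ... | _     | _     | _     | _     = 0#

    ∑N : (Fin m → Carrier) → Fin nv → (Fin nv → Carrier) → Carrier
    ∑N σ v g = ∑ nv (λ w → ∑ m (λ e → joins e v w * (σ e * g w)))

  -- J_{v0}(G,p) on V = Fin (suc n).  V ∖ {v0} is enumerated by
  -- punchIn v0 : Fin n → Fin (suc n).  Rows: E ⊎ ((V∖{v0}) × {d-k+1..d}),
  -- columns: V × {1..d}.
  module _ {n : ℕ} (G : SimpleGraph (ℕ.suc n)) where
    open SimpleGraph G

    J : ∀ {d k} (k≤d : k ≤ d) (v0 : Fin (ℕ.suc n)) (p : Fin (ℕ.suc n) → Fin d → Carrier) →
        (∀ i → ¬ (p v0 (top k≤d i) ≈ 0#)) →
        Fin m ⊎ (Fin n × Fin k) → (Fin (ℕ.suc n) × Fin d) → Carrier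
    J k≤d v0 p nz (inj₁ e) col = R G p e col
    J k≤d v0 p nz (inj₂ (v' , i)) (u , j)
      with u ≟ punchIn v0 v' | u ≟ v0 | j ≟ top k≤d i
    ... | yes _ | _     | yes _ = inv (p v0 (top k≤d i)) (nz i)
    ... | no _  | yes _ | yes _ =
          - (p (punchIn v0 v') (top k≤d i) * (inv (p v0 (top k≤d i)) (nz i)) ²)
    ... | _     | _     | _     = 0#

    InKerJᵀ : ∀ {d k} (k≤d : k ≤ d) (v0 : Fin (ℕ.suc n)) (p : Fin (ℕ.suc n) → Fin d → Carrier) →
              (∀ i → ¬ (p v0 (top k≤d i) ≈ 0#)) →
              (Fin m → Carrier) → (Fin n → Fin k → Carrier) → Set ℓ
    InKerJᵀ {d} {k} k≤d v0 p nz σ λ' = ∀ col →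
      ∑ m (λ e → J k≤d v0 p nz (inj₁ e) col * σ e)
        + ∑ n (λ v' → ∑ k (λ i → J k≤d v0 p nz (inj₂ (v' , i)) col * λ' v' i))
        ≈ 0#

-- The row (v, i) of J, v ≠ v0, meets only the columns (v, i) and (v0, i), both among the last k
-- coordinates. Hence the columns (u, j), j ≤ d - k, of Jᵀ(σ, λ) are those of DR_kᵀσ, and the column
-- (v, i), v ≠ v0, reads (R(G,p)ᵀσ)(v, i) + λ(v, i) / p_i(v0) = 0, which is the formula for λ because
-- (R(G,p)ᵀσ)(v, i) = Σ_{w ∈ N(v)} σ(vw) (p_i(v) - p_i(w)). Substituting λ, the column (v0, i) becomes
-- p_i(v0)⁻¹ Σ_u p_i(u) (R(G,p)ᵀσ)(u, i) = p_i(v0)⁻¹ Σ_{vw ∈ E} σ(vw) (p_i(v) - p_i(w))²,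
-- a nonzero multiple of the f_{G,1}(p_i) column of DR_kᵀσ.

module Submission where

open import Defs
open import Level using (Level)
open import Data.Nat as ℕ using (ℕ; suc; _≤_; _<_)
open import Data.Nat.Properties using (<⇒≤; m∸n+n≡m)
open import Data.Fin as Fin using (Fin; punchIn; punchOut; cast; join; splitAt; _↑ˡ_)
open import Data.Fin.Properties
  using (punchIn-injective; punchInᵢ≢i; punchIn-punchOut; toℕ-cast; toℕ-↑ˡ; toℕ-inject≤;
         toℕ-injective; cast-involutive; join-splitAt; splitAt-join; <⇒≢)
  renaming (_≟_ to _≟ᶠ_)
open import Data.Product using (_×_; _,_)
open import Data.Sum using (_⊎_; inj₁; inj₂)
open import Data.Sum.Properties using (inj₂-injective)
open import Data.Empty using (⊥-elim)
open import Function using (_∘_; _⇔_; mk⇔; Equivalence)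
open import Function.Properties.Equivalence using (⇔-setoid)
open import Relation.Nullary using (¬_; yes; no)
open import Relation.Binary.PropositionalEquality as ≡ using (_≡_; _≢_)
import Algebra.Properties.Ring as RingProperties
import Algebra.Properties.CommutativeSemigroup as CommutativeSemigroupProperties
import Algebra.Properties.Semiring.Sum as SemiringSum
import Relation.Binary.Reasoning.Setoid as SetoidReasoning

module FiniteSums {c ℓ : Level} (F : Field c ℓ) where
  open Field F
  open SemiringSum semiring
    using (sum; sum-cong-≋; sum-replicate-zero; sum-remove; ∑-comm; *-distribˡ-sum)
  open SetoidReasoning setoid

  ∑≡sum : ∀ n (f : Fin n → Carrier) → ∑ F n f ≡ sum f
  ∑≡sum ℕ.zero    f = ≡.refl
  ∑≡sum (suc n) f = ≡.cong (f Fin.zero +_) (∑≡sum n (f ∘ Fin.suc))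

  ∑-cong : ∀ n {f g : Fin n → Carrier} → (∀ i → f i ≈ g i) → ∑ F n f ≈ ∑ F n g
  ∑-cong n {f} {g} f≈g = begin
    ∑ F n f ≡⟨ ∑≡sum n f ⟩
    sum f   ≈⟨ sum-cong-≋ f≈g ⟩
    sum g   ≡⟨ ∑≡sum n g ⟨
    ∑ F n g ∎

  ∑-zero : ∀ n {f : Fin n → Carrier} → (∀ i → f i ≈ 0#) → ∑ F n f ≈ 0#
  ∑-zero n f≈0 = trans (∑-cong n f≈0) (trans (reflexive (∑≡sum n _)) (sum-replicate-zero n))

  ∑-swap : ∀ n m (f : Fin n → Fin m → Carrier) →
           ∑ F n (λ i → ∑ F m (f i)) ≈ ∑ F m (λ j → ∑ F n (λ i → f i j))
  ∑-swap n m f = begin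
    ∑ F n (λ i → ∑ F m (f i))          ≈⟨ ∑-cong n (λ i → reflexive (∑≡sum m (f i))) ⟩
    ∑ F n (λ i → sum (f i))            ≡⟨ ∑≡sum n _ ⟩
    sum (λ i → sum (f i))              ≈⟨ ∑-comm f ⟩
    sum (λ j → sum (λ i → f i j))      ≡⟨ ∑≡sum m _ ⟨
    ∑ F m (λ j → sum (λ i → f i j))    ≈⟨ ∑-cong m (λ j → reflexive (∑≡sum n _)) ⟨
    ∑ F m (λ j → ∑ F n (λ i → f i j))  ∎

  *-distribˡ-∑ : ∀ n x (f : Fin n → Carrier) → x * ∑ F n f ≈ ∑ F n (λ i → x * f i)
  *-distribˡ-∑ n x f = begin
    x * ∑ F n f             ≡⟨ ≡.cong (x *_) (∑≡sum n f) ⟩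
    x * sum f               ≈⟨ *-distribˡ-sum x f ⟩
    sum (λ i → x * f i)     ≡⟨ ∑≡sum n _ ⟨
    ∑ F n (λ i → x * f i)   ∎

  ∑-punchIn : ∀ n (i : Fin (suc n)) (f : Fin (suc n) → Carrier) →
              ∑ F (suc n) f ≈ f i + ∑ F n (f ∘ punchIn i)
  ∑-punchIn n i f = begin
    ∑ F (suc n) f                ≡⟨ ∑≡sum (suc n) f ⟩
    sum f                        ≈⟨ sum-remove f ⟩
    f i + sum (f ∘ punchIn i)    ≡⟨ ≡.cong (f i +_) (∑≡sum n _) ⟨
    f i + ∑ F n (f ∘ punchIn i)  ∎

  ∑-single : ∀ {n} {f : Fin n → Carrier} i → (∀ j → j ≢ i → f j ≈ 0#) → ∑ F n f ≈ f i
  ∑-single {suc n} {f} i f≈0 = begin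
    ∑ F (suc n) f                ≈⟨ ∑-punchIn n i f ⟩
    f i + ∑ F n (f ∘ punchIn i)  ≈⟨ +-congˡ (∑-zero n λ j → f≈0 (punchIn i j) (punchInᵢ≢i i j)) ⟩
    f i + 0#                     ≈⟨ +-identityʳ (f i) ⟩
    f i                          ∎

  ∑-pair : ∀ {n} {f : Fin n → Carrier} {i j} → i ≢ j →
           (∀ l → l ≢ i → l ≢ j → f l ≈ 0#) → ∑ F n f ≈ f i + f j
  ∑-pair {suc n} {f} {i} {j} i≢j f≈0 = begin
    ∑ F (suc n) f                       ≈⟨ ∑-punchIn n i f ⟩
    f i + ∑ F n (f ∘ punchIn i)         ≈⟨ +-congˡ (∑-single (punchOut i≢j) rest≈0) ⟩
    f i + f (punchIn i (punchOut i≢j))  ≡⟨ ≡.cong (λ l → f i + f l) (punchIn-punchOut i≢j) ⟩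
    f i + f j                           ∎
    where
    rest≈0 : ∀ l → l ≢ punchOut i≢j → f (punchIn i l) ≈ 0#
    rest≈0 l l≢j′ = f≈0 (punchIn i l) (punchInᵢ≢i i l) λ l≡j →
      l≢j′ (punchIn-injective i l _ (≡.trans l≡j (≡.sym (punchIn-punchOut i≢j))))

punchIn-cases : ∀ {n p} {P : Fin (suc n) → Set p} (i : Fin (suc n)) →
                P i → (∀ j → P (punchIn i j)) → ∀ j → P j
punchIn-cases {P = P} i onI onPunchIn j with i ≟ᶠ j
... | yes ≡.refl = onI
... | no i≢j     = ≡.subst P (punchIn-punchOut i≢j) (onPunchIn (punchOut i≢j))

module Coordinates {d k : ℕ} (k≤d : k ≤ d) where
  private
    d∸k+k≡d : d ℕ.∸ k ℕ.+ k ≡ d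
    d∸k+k≡d = m∸n+n≡m k≤d

  coordinate : Fin (d ℕ.∸ k) ⊎ Fin k → Fin d
  coordinate = cast d∸k+k≡d ∘ join (d ℕ.∸ k) k

  coordinate⁻¹ : Fin d → Fin (d ℕ.∸ k) ⊎ Fin k
  coordinate⁻¹ = splitAt (d ℕ.∸ k) ∘ cast (≡.sym d∸k+k≡d)

  coordinate⁻¹-coordinate : ∀ c → coordinate⁻¹ (coordinate c) ≡ c
  coordinate⁻¹-coordinate c = ≡.trans
    (≡.cong (splitAt (d ℕ.∸ k)) (cast-involutive (≡.sym d∸k+k≡d) d∸k+k≡d (join (d ℕ.∸ k) k c)))
    (splitAt-join (d ℕ.∸ k) k c)

  coordinate-coordinate⁻¹ : ∀ j → coordinate (coordinate⁻¹ j) ≡ j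
  coordinate-coordinate⁻¹ j = ≡.trans
    (≡.cong (cast d∸k+k≡d) (join-splitAt (d ℕ.∸ k) k (cast (≡.sym d∸k+k≡d) j)))
    (cast-involutive d∸k+k≡d (≡.sym d∸k+k≡d) j)

  coordinate-injective : ∀ {c c′} → coordinate c ≡ coordinate c′ → c ≡ c′
  coordinate-injective {c} {c′} eq = begin
    c                             ≡⟨ coordinate⁻¹-coordinate c ⟨
    coordinate⁻¹ (coordinate c)   ≡⟨ ≡.cong coordinate⁻¹ eq ⟩
    coordinate⁻¹ (coordinate c′)  ≡⟨ coordinate⁻¹-coordinate c′ ⟩
    c′                            ∎
    where open ≡.≡-Reasoning

  bot≡coordinate : ∀ a → bot k a ≡ coordinate (inj₁ a)
  bot≡coordinate a = toℕ-injective (≡.trans (toℕ-inject≤ a _)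
    (≡.sym (≡.trans (toℕ-cast d∸k+k≡d (a ↑ˡ k)) (toℕ-↑ˡ a k))))

  bot≢top : ∀ a i → bot k a ≢ top k≤d i
  bot≢top a i eq with coordinate-injective {inj₁ a} {inj₂ i} (≡.trans (≡.sym (bot≡coordinate a)) eq)
  ... | ()

  top-injective : ∀ {i i′} → top k≤d i ≡ top k≤d i′ → i ≡ i′
  top-injective {i} {i′} = inj₂-injective ∘ coordinate-injective {inj₂ i} {inj₂ i′}

  coordinate-cases : ∀ {p} {P : Fin d → Set p} →
                     (∀ a → P (bot k a)) → (∀ i → P (top k≤d i)) → ∀ j → P j
  coordinate-cases {P = P} onBot onTop j =
    ≡.subst P (coordinate-coordinate⁻¹ j) (onCoordinate (coordinate⁻¹ j))
    where
    onCoordinate : ∀ c → P (coordinate c)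
    onCoordinate (inj₁ a) = ≡.subst P (bot≡coordinate a) (onBot a)
    onCoordinate (inj₂ i) = onTop i

  column-cases : ∀ {nv p} {P : Fin (suc nv) × Fin d → Set p} (v0 : Fin (suc nv)) →
                 (∀ u a → P (u , bot k a)) → (∀ i → P (v0 , top k≤d i)) →
                 (∀ v′ i → P (punchIn v0 v′ , top k≤d i)) → ∀ col → P col
  column-cases {P = P} v0 onBot onV0 onPunchIn (u , j) = coordinate-cases (onBot u)
    (λ i → punchIn-cases {P = λ u → P (u , top k≤d i)} v0 (onV0 i) (λ v′ → onPunchIn v′ i) u) j

module FieldLemmas {c ℓ : Level} (F : Field c ℓ) where
  open Field F
  open RingProperties ring
  open CommutativeSemigroupProperties *-commutativeSemigroup using (x∙yz≈y∙xz)
  open SetoidReasoning setoid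

  x≡0⇒x*y≈0 : ∀ {x} y → x ≡ 0# → x * y ≈ 0#
  x≡0⇒x*y≈0 y ≡.refl = zeroˡ y

  x[x-y]z+y[y-x]z≈[x-y]²z : ∀ x y z → x * ((x - y) * z) + y * ((y - x) * z) ≈ (x - y) * (x - y) * z
  x[x-y]z+y[y-x]z≈[x-y]²z x y z = begin
    x * ((x - y) * z) + y * ((y - x) * z)    ≈⟨ +-congˡ (*-congˡ (*-congʳ (⁻¹-anti-homo‿- x y))) ⟨
    x * ((x - y) * z) + y * (- (x - y) * z)  ≈⟨ +-congˡ (*-congˡ (-‿distribˡ-* (x - y) z)) ⟨
    x * ((x - y) * z) + y * - ((x - y) * z)  ≈⟨ +-congˡ (-‿distribʳ-* y ((x - y) * z)) ⟨
    x * ((x - y) * z) - y * ((x - y) * z)    ≈⟨ [y-z]x≈yx-zx ((x - y) * z) x y ⟨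
    (x - y) * ((x - y) * z)                  ≈⟨ *-assoc (x - y) (x - y) z ⟨
    (x - y) * (x - y) * z                    ∎

  x+y≈0⇔y≈-x : ∀ {x y} → x + y ≈ 0# ⇔ y ≈ - x
  x+y≈0⇔y≈-x {x} {y} = mk⇔ (+-inverseʳ-unique x y) (λ y≈-x → trans (+-congˡ y≈-x) (-‿inverseʳ x))

  ≈-respˡ-⇔ : ∀ {x y z} → x ≈ y → x ≈ z ⇔ y ≈ z
  ≈-respˡ-⇔ x≈y = mk⇔ (trans (sym x≈y)) (trans x≈y)

  ≈-respʳ-⇔ : ∀ {x y z} → y ≈ z → x ≈ y ⇔ x ≈ z
  ≈-respʳ-⇔ y≈z = mk⇔ (λ x≈y → trans x≈y y≈z) (λ x≈z → trans x≈z (sym y≈z))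

  module _ {a a⁻¹ : Carrier} (aa⁻¹≈1 : a * a⁻¹ ≈ 1#) where

    a[a⁻¹x]≈x : ∀ x → a * (a⁻¹ * x) ≈ x
    a[a⁻¹x]≈x x = begin
      a * (a⁻¹ * x)  ≈⟨ *-assoc a a⁻¹ x ⟨
      a * a⁻¹ * x    ≈⟨ *-congʳ aa⁻¹≈1 ⟩
      1# * x         ≈⟨ *-identityˡ x ⟩
      x              ∎

    a⁻¹[ax]≈x : ∀ x → a⁻¹ * (a * x) ≈ x
    a⁻¹[ax]≈x x = trans (x∙yz≈y∙xz a⁻¹ a x) (a[a⁻¹x]≈x x)

    x+a⁻¹y≈0⇔ax+y≈0 : ∀ {x y} → x + a⁻¹ * y ≈ 0# ⇔ a * x + y ≈ 0#
    x+a⁻¹y≈0⇔ax+y≈0 {x} {y} = mk⇔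
      (λ eq → begin
        a * x + y                ≈⟨ +-congˡ (a[a⁻¹x]≈x y) ⟨
        a * x + a * (a⁻¹ * y)    ≈⟨ distribˡ a x (a⁻¹ * y) ⟨
        a * (x + a⁻¹ * y)        ≈⟨ *-congˡ eq ⟩
        a * 0#                   ≈⟨ zeroʳ a ⟩
        0#                       ∎)
      (λ eq → begin
        x + a⁻¹ * y              ≈⟨ +-congʳ (a⁻¹[ax]≈x x) ⟨
        a⁻¹ * (a * x) + a⁻¹ * y  ≈⟨ distribˡ a⁻¹ (a * x) y ⟨
        a⁻¹ * (a * x + y)        ≈⟨ *-congˡ eq ⟩
        a⁻¹ * 0#                 ≈⟨ zeroʳ a⁻¹ ⟩
        0#                       ∎)

    -[ya⁻¹²]*-[az]≈a⁻¹[yz] : ∀ y z → - (y * (a⁻¹ * a⁻¹)) * - (a * z) ≈ a⁻¹ * (y * z)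
    -[ya⁻¹²]*-[az]≈a⁻¹[yz] y z = begin
      - (y * (a⁻¹ * a⁻¹)) * - (a * z)    ≈⟨ -‿distribʳ-* _ (a * z) ⟨
      - (- (y * (a⁻¹ * a⁻¹)) * (a * z))  ≈⟨ -‿cong (-‿distribˡ-* _ (a * z)) ⟨
      - - (y * (a⁻¹ * a⁻¹) * (a * z))    ≈⟨ -‿involutive _ ⟩
      y * (a⁻¹ * a⁻¹) * (a * z)          ≈⟨ *-assoc y (a⁻¹ * a⁻¹) (a * z) ⟩
      y * (a⁻¹ * a⁻¹ * (a * z))          ≈⟨ *-congˡ (*-assoc a⁻¹ a⁻¹ (a * z)) ⟩
      y * (a⁻¹ * (a⁻¹ * (a * z)))        ≈⟨ *-congˡ (*-congˡ (a⁻¹[ax]≈x z)) ⟩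
      y * (a⁻¹ * z)                      ≈⟨ x∙yz≈y∙xz y a⁻¹ z ⟩
      a⁻¹ * (y * z)                      ∎

module RigidityMatrix {c ℓ : Level} (F : Field c ℓ) {nv : ℕ} (G : SimpleGraph nv) where
  open Field F
  open SimpleGraph G
  open FiniteSums F
  open FieldLemmas F using (x≡0⇒x*y≈0; x[x-y]z+y[y-x]z≈[x-y]²z)
  open SetoidReasoning setoid

  tl≢hd : ∀ e → tl e ≢ hd e
  tl≢hd e = <⇒≢ (tl<hd e)

  module _ {r : ℕ} (x : Fin nv → Fin r → Carrier) (e : Fin m) (j : Fin r) where

    R-tl : R F G x e (tl e , j) ≡ x (tl e) j - x (hd e) j
    R-tl with tl e ≟ᶠ tl e
    ... | yes _    = ≡.refl
    ... | no tl≢tl = ⊥-elim (tl≢tl ≡.refl)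

    R-hd : R F G x e (hd e , j) ≡ x (hd e) j - x (tl e) j
    R-hd with hd e ≟ᶠ tl e | hd e ≟ᶠ hd e
    ... | yes hd≡tl | _        = ⊥-elim (tl≢hd e (≡.sym hd≡tl))
    ... | no _      | yes _    = ≡.refl
    ... | no _      | no hd≢hd = ⊥-elim (hd≢hd ≡.refl)

    R-other : ∀ v → v ≢ tl e → v ≢ hd e → R F G x e (v , j) ≡ 0#
    R-other v v≢tl v≢hd with v ≟ᶠ tl e | v ≟ᶠ hd e
    ... | yes v≡tl | _        = ⊥-elim (v≢tl v≡tl)
    ... | no _     | yes v≡hd = ⊥-elim (v≢hd v≡hd)
    ... | no _     | no _     = ≡.refl

  R-reindex : ∀ {r s} (x : Fin nv → Fin s → Carrier) (π : Fin r → Fin s) e v j →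
              R F G (λ u → x u ∘ π) e (v , j) ≡ R F G x e (v , π j)
  R-reindex x π e v j with v ≟ᶠ tl e | v ≟ᶠ hd e
  ... | yes _ | _     = ≡.refl
  ... | no _  | yes _ = ≡.refl
  ... | no _  | no _  = ≡.refl

  module _ (e : Fin m) where

    joins-tl-hd : joins F G e (tl e) (hd e) ≡ 1#
    joins-tl-hd with tl e ≟ᶠ tl e | hd e ≟ᶠ hd e
    ... | yes _    | yes _    = ≡.refl
    ... | no tl≢tl | _        = ⊥-elim (tl≢tl ≡.refl)
    ... | yes _    | no hd≢hd = ⊥-elim (hd≢hd ≡.refl)

    joins-hd-tl : joins F G e (hd e) (tl e) ≡ 1#
    joins-hd-tl with tl e ≟ᶠ hd e | hd e ≟ᶠ tl e | tl e ≟ᶠ tl e | hd e ≟ᶠ hd e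
    ... | yes tl≡hd | _ | _        | _        = ⊥-elim (tl≢hd e tl≡hd)
    ... | no _      | _ | yes _    | yes _    = ≡.refl
    ... | no _      | _ | no tl≢tl | _        = ⊥-elim (tl≢tl ≡.refl)
    ... | no _      | _ | yes _    | no hd≢hd = ⊥-elim (hd≢hd ≡.refl)

    joins-other : ∀ u w → (tl e ≡ u → hd e ≢ w) → (tl e ≡ w → hd e ≢ u) → joins F G e u w ≡ 0#
    joins-other u w ¬tl-hd ¬hd-tl with tl e ≟ᶠ u | hd e ≟ᶠ w | tl e ≟ᶠ w | hd e ≟ᶠ u
    ... | yes tl≡u | yes hd≡w | _        | _        = ⊥-elim (¬tl-hd tl≡u hd≡w)
    ... | _        | _        | yes tl≡w | yes hd≡u = ⊥-elim (¬hd-tl tl≡w hd≡u)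
    ... | yes _    | no _     | yes _    | no _     = ≡.refl
    ... | yes _    | no _     | no _     | _        = ≡.refl
    ... | no _     | _        | yes _    | no _     = ≡.refl
    ... | no _     | _        | no _     | _        = ≡.refl

    joins-tl-≢hd : ∀ w → w ≢ hd e → joins F G e (tl e) w ≡ 0#
    joins-tl-≢hd w w≢hd = joins-other (tl e) w
      (λ _ hd≡w → w≢hd (≡.sym hd≡w)) (λ _ hd≡tl → tl≢hd e (≡.sym hd≡tl))

    joins-hd-≢tl : ∀ w → w ≢ tl e → joins F G e (hd e) w ≡ 0#
    joins-hd-≢tl w w≢tl = joins-other (hd e) w
      (λ tl≡hd _ → tl≢hd e tl≡hd) (λ tl≡w _ → w≢tl (≡.sym tl≡w))

    joins-≢endpoints : ∀ u w → u ≢ tl e → u ≢ hd e → joins F G e u w ≡ 0#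
    joins-≢endpoints u w u≢tl u≢hd = joins-other u w
      (λ tl≡u → ⊥-elim (u≢tl (≡.sym tl≡u))) (λ _ hd≡u → u≢hd (≡.sym hd≡u))

    ∑-joins : ∀ u w₀ (g : Fin nv → Carrier) → joins F G e u w₀ ≡ 1# →
              (∀ w → w ≢ w₀ → joins F G e u w ≡ 0#) →
              ∑ F nv (λ w → joins F G e u w * g w) ≈ g w₀
    ∑-joins u w₀ g joins≡1 joins≡0 = begin
      ∑ F nv (λ w → joins F G e u w * g w)
        ≈⟨ ∑-single w₀ (λ w w≢w₀ → x≡0⇒x*y≈0 (g w) (joins≡0 w w≢w₀)) ⟩
      joins F G e u w₀ * g w₀               ≡⟨ ≡.cong (_* g w₀) joins≡1 ⟩
      1# * g w₀                             ≈⟨ *-identityˡ (g w₀) ⟩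
      g w₀                                  ∎

  Rᵀ : ∀ {r} → (Fin nv → Fin r → Carrier) → (Fin m → Carrier) → Fin nv × Fin r → Carrier
  Rᵀ x σ col = ∑ F m (λ e → R F G x e col * σ e)

  module _ {r : ℕ} (x : Fin nv → Fin r → Carrier) (σ : Fin m → Carrier) (j : Fin r) where

    ∑-joins-R : ∀ e u → ∑ F nv (λ w → joins F G e u w * (σ e * (x u j - x w j)))
                        ≈ R F G x e (u , j) * σ e
    ∑-joins-R e u with u ≟ᶠ tl e | u ≟ᶠ hd e
    ... | yes ≡.refl | _ =
      trans (∑-joins e (tl e) (hd e) _ (joins-tl-hd e) (joins-tl-≢hd e)) (*-comm (σ e) _)
    ... | no _ | yes ≡.refl =
      trans (∑-joins e (hd e) (tl e) _ (joins-hd-tl e) (joins-hd-≢tl e)) (*-comm (σ e) _)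
    ... | no u≢tl | no u≢hd = begin
      ∑ F nv (λ w → joins F G e u w * (σ e * (x u j - x w j)))
        ≈⟨ ∑-zero nv (λ w → x≡0⇒x*y≈0 _ (joins-≢endpoints e u w u≢tl u≢hd)) ⟩
      0#        ≈⟨ zeroˡ (σ e) ⟨
      0# * σ e  ∎

    Rᵀ≈∑N : ∀ u → Rᵀ x σ (u , j) ≈ ∑N F G σ u (λ w → x u j - x w j)
    Rᵀ≈∑N u = begin
      ∑ F m (λ e → R F G x e (u , j) * σ e)
        ≈⟨ ∑-cong m (λ e → ∑-joins-R e u) ⟨
      ∑ F m (λ e → ∑ F nv (λ w → joins F G e u w * (σ e * (x u j - x w j))))
        ≈⟨ ∑-swap m nv _ ⟩
      ∑N F G σ u (λ w → x u j - x w j) ∎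

    ∑x*R*σ≈f1*σ : ∀ e → ∑ F nv (λ u → x u j * (R F G x e (u , j) * σ e))
                          ≈ f1 F G (λ v → x v j) e * σ e
    ∑x*R*σ≈f1*σ e = begin
      ∑ F nv (λ u → x u j * (R F G x e (u , j) * σ e))
        ≈⟨ ∑-pair (tl≢hd e) (λ v v≢tl v≢hd →
             trans (*-congˡ (x≡0⇒x*y≈0 (σ e) (R-other x e j v v≢tl v≢hd))) (zeroʳ (x v j))) ⟩
      x (tl e) j * (R F G x e (tl e , j) * σ e) + x (hd e) j * (R F G x e (hd e , j) * σ e)
        ≡⟨ ≡.cong₂ (λ s t → x (tl e) j * (s * σ e) + x (hd e) j * (t * σ e))
                   (R-tl x e j) (R-hd x e j) ⟩
      x (tl e) j * ((x (tl e) j - x (hd e) j) * σ e) + x (hd e) j * ((x (hd e) j - x (tl e) j) * σ e)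
        ≈⟨ x[x-y]z+y[y-x]z≈[x-y]²z (x (tl e) j) (x (hd e) j) (σ e) ⟩
      f1 F G (λ v → x v j) e * σ e ∎

    ∑f1*σ≈∑x*Rᵀ : ∑ F m (λ e → f1 F G (λ v → x v j) e * σ e)
                  ≈ ∑ F nv (λ u → x u j * Rᵀ x σ (u , j))
    ∑f1*σ≈∑x*Rᵀ = begin
      ∑ F m (λ e → f1 F G (λ v → x v j) e * σ e)
        ≈⟨ ∑-cong m ∑x*R*σ≈f1*σ ⟨
      ∑ F m (λ e → ∑ F nv (λ u → x u j * (R F G x e (u , j) * σ e)))
        ≈⟨ ∑-swap m nv _ ⟩
      ∑ F nv (λ u → ∑ F m (λ e → x u j * (R F G x e (u , j) * σ e)))
        ≈⟨ ∑-cong nv (λ u → *-distribˡ-∑ m (x u j) _) ⟨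
      ∑ F nv (λ u → x u j * Rᵀ x σ (u , j)) ∎

-- Row (v, i) of J is the gradient of p ↦ p_i(v) / p_i(v0).
module NormalisationRows
  {c ℓ : Level} (F : Field c ℓ) {d k : ℕ} (k≤d : k ≤ d) {n : ℕ} (G : SimpleGraph (suc n))
  (v0 : Fin (suc n)) (p : Fin (suc n) → Fin d → Field.Carrier F)
  (nz : ∀ i → ¬ (Field._≈_ F (p v0 (top k≤d i)) (Field.0# F)))
  where
  open Field F
  open FiniteSums F
  open FieldLemmas F using (x≡0⇒x*y≈0)
  open Coordinates k≤d
  open SetoidReasoning setoid

  Jₙ : Fin n × Fin k → Fin (suc n) × Fin d → Carrier
  Jₙ row = J F G k≤d v0 p nz (inj₂ row)

  p₀⁻¹ : Fin k → Carrier
  p₀⁻¹ i = inv (p v0 (top k≤d i)) (nz i)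

  J-off-coordinate : ∀ v′ i u j → j ≢ top k≤d i → Jₙ (v′ , i) (u , j) ≡ 0#
  J-off-coordinate v′ i u j j≢top with u ≟ᶠ punchIn v0 v′ | u ≟ᶠ v0 | j ≟ᶠ top k≤d i
  ... | _     | _     | yes j≡top = ⊥-elim (j≢top j≡top)
  ... | yes _ | _     | no _      = ≡.refl
  ... | no _  | yes _ | no _      = ≡.refl
  ... | no _  | no _  | no _      = ≡.refl

  J-off-vertex : ∀ v′ i v″ j → v′ ≢ v″ → Jₙ (v′ , i) (punchIn v0 v″ , j) ≡ 0#
  J-off-vertex v′ i v″ j v′≢v″
    with punchIn v0 v″ ≟ᶠ punchIn v0 v′ | punchIn v0 v″ ≟ᶠ v0 | j ≟ᶠ top k≤d i
  ... | yes eq | _      | _     = ⊥-elim (v′≢v″ (punchIn-injective v0 v′ v″ (≡.sym eq)))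
  ... | no _   | yes eq | _     = ⊥-elim (punchInᵢ≢i v0 v″ eq)
  ... | no _   | no _   | yes _ = ≡.refl
  ... | no _   | no _   | no _  = ≡.refl

  J-diagonal : ∀ v′ i → Jₙ (v′ , i) (punchIn v0 v′ , top k≤d i) ≡ p₀⁻¹ i
  J-diagonal v′ i with punchIn v0 v′ ≟ᶠ punchIn v0 v′ | top k≤d i ≟ᶠ top k≤d i
  ... | yes _  | yes _  = ≡.refl
  ... | no neq | _      = ⊥-elim (neq ≡.refl)
  ... | yes _  | no neq = ⊥-elim (neq ≡.refl)

  J-v0 : ∀ v′ i →
         Jₙ (v′ , i) (v0 , top k≤d i) ≡ - (p (punchIn v0 v′) (top k≤d i) * (p₀⁻¹ i * p₀⁻¹ i))
  J-v0 v′ i with v0 ≟ᶠ punchIn v0 v′ | v0 ≟ᶠ v0 | top k≤d i ≟ᶠ top k≤d i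
  ... | yes eq | _      | _      = ⊥-elim (punchInᵢ≢i v0 v′ (≡.sym eq))
  ... | no _   | yes _  | yes _  = ≡.refl
  ... | no _   | no neq | _      = ⊥-elim (neq ≡.refl)
  ... | no _   | yes _  | no neq = ⊥-elim (neq ≡.refl)

  module _ (λ′ : Fin n → Fin k → Carrier) where

    Jᵀλ : Fin (suc n) × Fin d → Carrier
    Jᵀλ col = ∑ F n (λ v′ → ∑ F k (λ i → Jₙ (v′ , i) col * λ′ v′ i))

    Jᵀλ-bot : ∀ u a → Jᵀλ (u , bot k a) ≈ 0#
    Jᵀλ-bot u a = ∑-zero n λ v′ → ∑-zero k λ i →
      x≡0⇒x*y≈0 (λ′ v′ i) (J-off-coordinate v′ i u (bot k a) (bot≢top a i))

    ∑-Jₙ-top : ∀ v′ u i → ∑ F k (λ i′ → Jₙ (v′ , i′) (u , top k≤d i) * λ′ v′ i′)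
                          ≈ Jₙ (v′ , i) (u , top k≤d i) * λ′ v′ i
    ∑-Jₙ-top v′ u i = ∑-single i λ i′ i′≢i → x≡0⇒x*y≈0 (λ′ v′ i′)
      (J-off-coordinate v′ i′ u (top k≤d i) (i′≢i ∘ ≡.sym ∘ top-injective))

    Jᵀλ-punchIn : ∀ v′ i → Jᵀλ (punchIn v0 v′ , top k≤d i) ≈ p₀⁻¹ i * λ′ v′ i
    Jᵀλ-punchIn v′ i = begin
      Jᵀλ (punchIn v0 v′ , top k≤d i)
        ≈⟨ ∑-single v′ (λ v″ v″≢v′ → ∑-zero k λ i′ →
             x≡0⇒x*y≈0 (λ′ v″ i′) (J-off-vertex v″ i′ v′ (top k≤d i) v″≢v′)) ⟩
      ∑ F k (λ i′ → Jₙ (v′ , i′) (punchIn v0 v′ , top k≤d i) * λ′ v′ i′)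
        ≈⟨ ∑-Jₙ-top v′ (punchIn v0 v′) i ⟩
      Jₙ (v′ , i) (punchIn v0 v′ , top k≤d i) * λ′ v′ i
        ≡⟨ ≡.cong (_* λ′ v′ i) (J-diagonal v′ i) ⟩
      p₀⁻¹ i * λ′ v′ i ∎

    Jᵀλ-v0 : ∀ i → Jᵀλ (v0 , top k≤d i)
                   ≈ ∑ F n (λ v′ → - (p (punchIn v0 v′) (top k≤d i) * (p₀⁻¹ i * p₀⁻¹ i))
                                   * λ′ v′ i)
    Jᵀλ-v0 i = ∑-cong n λ v′ → trans (∑-Jₙ-top v′ v0 i) (*-congʳ (reflexive (J-v0 v′ i)))

module KernelColumns
  {c ℓ : Level} (F : Field c ℓ) {d k : ℕ} (k≤d : k ≤ d) {n : ℕ} (G : SimpleGraph (suc n))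
  (v0 : Fin (suc n)) (p : Fin (suc n) → Fin d → Field.Carrier F)
  (nz : ∀ i → ¬ (Field._≈_ F (p v0 (top k≤d i)) (Field.0# F)))
  (σ : Fin (SimpleGraph.m G) → Field.Carrier F) (λ′ : Fin n → Fin k → Field.Carrier F)
  where
  open Field F
  open SimpleGraph G using (m)
  open FiniteSums F
  open FieldLemmas F
  open RigidityMatrix F G
  open NormalisationRows F k≤d G v0 p nz
  open SetoidReasoning (⇔-setoid ℓ)

  p₀ : Fin k → Carrier
  p₀ i = p v0 (top k≤d i)

  p₀p₀⁻¹≈1 : ∀ i → p₀ i * p₀⁻¹ i ≈ 1#
  p₀p₀⁻¹≈1 i = inv-r (p₀ i) (nz i)

  ColumnVanishes : Fin (suc n) × Fin d → Set ℓ
  ColumnVanishes col = Rᵀ p σ col + Jᵀλ λ′ col ≈ 0#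

  MultiplierFormula : Fin n → Fin k → Set ℓ
  MultiplierFormula v′ i =
    λ′ v′ i ≈ - (p₀ i * ∑N F G σ (punchIn v0 v′)
                              (λ w → p (punchIn v0 v′) (top k≤d i) - p w (top k≤d i)))

  column-bot : ∀ u a → ColumnVanishes (u , bot k a) ⇔ Rᵀ (λ v → p v ∘ bot k) σ (u , a) ≈ 0#
  column-bot u a = begin
    ColumnVanishes (u , bot k a)
      ≈⟨ ≈-respˡ-⇔ (trans (+-congˡ (Jᵀλ-bot λ′ u a)) (+-identityʳ _)) ⟩
    Rᵀ p σ (u , bot k a) ≈ 0#
      ≈⟨ ≈-respˡ-⇔ (∑-cong m λ e → *-congʳ (reflexive (≡.sym (R-reindex p (bot k) e u a)))) ⟩
    Rᵀ (λ v → p v ∘ bot k) σ (u , a) ≈ 0# ∎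

  column-punchIn : ∀ v′ i → ColumnVanishes (punchIn v0 v′ , top k≤d i) ⇔ MultiplierFormula v′ i
  column-punchIn v′ i = begin
    ColumnVanishes (punchIn v0 v′ , top k≤d i)
      ≈⟨ ≈-respˡ-⇔ (+-congˡ (Jᵀλ-punchIn λ′ v′ i)) ⟩
    S + p₀⁻¹ i * λ′ v′ i ≈ 0#
      ≈⟨ x+a⁻¹y≈0⇔ax+y≈0 (p₀p₀⁻¹≈1 i) ⟩
    p₀ i * S + λ′ v′ i ≈ 0#
      ≈⟨ x+y≈0⇔y≈-x ⟩
    λ′ v′ i ≈ - (p₀ i * S)
      ≈⟨ ≈-respʳ-⇔ (-‿cong (*-congˡ (Rᵀ≈∑N p σ (top k≤d i) (punchIn v0 v′)))) ⟩
    MultiplierFormula v′ i ∎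
    where
    S : Carrier
    S = Rᵀ p σ (punchIn v0 v′ , top k≤d i)

  column-v0 : ∀ i → (∀ v′ → MultiplierFormula v′ i) →
              ColumnVanishes (v0 , top k≤d i)
                ⇔ ∑ F m (λ e → f1 F G (λ v → p v (top k≤d i)) e * σ e) ≈ 0#
  column-v0 i formula = begin
    ColumnVanishes (v0 , top k≤d i)
      ≈⟨ ≈-respˡ-⇔ (+-congˡ Jᵀλ≈p₀⁻¹Q) ⟩
    S v0 + p₀⁻¹ i * Q ≈ 0#
      ≈⟨ x+a⁻¹y≈0⇔ax+y≈0 (p₀p₀⁻¹≈1 i) ⟩
    p₀ i * S v0 + Q ≈ 0#
      ≈⟨ ≈-respˡ-⇔ (∑-punchIn n v0 (λ u → p u (top k≤d i) * S u)) ⟨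
    ∑ F (suc n) (λ u → p u (top k≤d i) * S u) ≈ 0#
      ≈⟨ ≈-respˡ-⇔ (∑f1*σ≈∑x*Rᵀ p σ (top k≤d i)) ⟨
    ∑ F m (λ e → f1 F G (λ v → p v (top k≤d i)) e * σ e) ≈ 0# ∎
    where
    S : Fin (suc n) → Carrier
    S u = Rᵀ p σ (u , top k≤d i)

    Q : Carrier
    Q = ∑ F n (λ v′ → p (punchIn v0 v′) (top k≤d i) * S (punchIn v0 v′))

    λ′≈-p₀S : ∀ v′ → λ′ v′ i ≈ - (p₀ i * S (punchIn v0 v′))
    λ′≈-p₀S v′ = trans (formula v′) (-‿cong (*-congˡ (sym (Rᵀ≈∑N p σ (top k≤d i) _))))

    Jᵀλ≈p₀⁻¹Q : Jᵀλ λ′ (v0 , top k≤d i) ≈ p₀⁻¹ i * Q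
    Jᵀλ≈p₀⁻¹Q = trans (Jᵀλ-v0 λ′ i) (trans
      (∑-cong n λ v′ → trans (*-congˡ (λ′≈-p₀S v′))
                             (-[ya⁻¹²]*-[az]≈a⁻¹[yz] (p₀p₀⁻¹≈1 i) _ _))
      (sym (*-distribˡ-∑ n (p₀⁻¹ i) _)))

lemma5p2 : ∀ {c ℓ : Level} (F : Field c ℓ) (d k : ℕ) (1≤k : 1 ≤ k) (k<d : k < d)
    {n : ℕ} (G : SimpleGraph (suc n)) (v0 : Fin (suc n))
    (p : Fin (suc n) → Fin d → Field.Carrier F)
    (nz : ∀ i → ¬ (Field._≈_ F (p v0 (top (<⇒≤ k<d) i)) (Field.0# F)))
    (σ : Fin (SimpleGraph.m G) → Field.Carrier F)
    (λ' : Fin n → Fin k → Field.Carrier F) →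
    InKerJᵀ F G (<⇒≤ k<d) v0 p nz σ λ'
      ⇔ (InKerDRᵀ F G k (<⇒≤ k<d) p σ
         × (∀ (v' : Fin n) (i : Fin k) →
              Field._≈_ F (λ' v' i)
                (Field.-_ F (Field._*_ F (p v0 (top (<⇒≤ k<d) i))
                  (∑N F G σ (punchIn v0 v')
                    (λ w → Field._-_ F (p (punchIn v0 v') (top (<⇒≤ k<d) i))
                                       (p w (top (<⇒≤ k<d) i))))))))
lemma5p2 F d k _ k<d G v0 p nz σ λ′ = mk⇔
  (λ inKerJᵀ → inKerDRᵀ inKerJᵀ , multiplierFormula inKerJᵀ)
  (λ (σ∈kerDRᵀ , formula) → column-cases v0
    (λ u a → from (column-bot u a) (σ∈kerDRᵀ (inj₁ (u , a))))
    (λ i → from (column-v0 i (λ v′ → formula v′ i)) (σ∈kerDRᵀ (inj₂ i)))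
    (λ v′ i → from (column-punchIn v′ i) (formula v′ i)))
  where
  k≤d : k ≤ d
  k≤d = <⇒≤ k<d

  open Coordinates k≤d
  open KernelColumns F k≤d G v0 p nz σ λ′
  open Equivalence

  multiplierFormula : InKerJᵀ F G k≤d v0 p nz σ λ′ → ∀ v′ i → MultiplierFormula v′ i
  multiplierFormula inKerJᵀ v′ i = to (column-punchIn v′ i) (inKerJᵀ (punchIn v0 v′ , top k≤d i))

  inKerDRᵀ : InKerJᵀ F G k≤d v0 p nz σ λ′ → InKerDRᵀ F G k k≤d p σ
  inKerDRᵀ inKerJᵀ (inj₁ (u , a)) = to (column-bot u a) (inKerJᵀ (u , bot k a))
  inKerDRᵀ inKerJᵀ (inj₂ i)       =
    to (column-v0 i (λ v′ → multiplierFormula inKerJᵀ v′ i)) (inKerJᵀ (v0 , top k≤d i))
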